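{- For any graphs $G$ and $H$, $\mu_{\mathrm{int}}(G\square H)\le\max\{\mu_{\mathrm{int}}(G),\mu_{\mathrm{int}}(H)\}$.
   Context: Graphs are finite and simple. The Cartesian product $G\square H$ has vertex set $V(G)\times V(H)$, with $(u_1,v_1)$ adjacent to $(u_2,v_2)$ iff either $u_1=u_2$ and $v_1v_2\in E(H)$, or $v_1=v_2$ and $u_1u_2\in E(G)$. A $k$-improper edge coloring of a graph is a map $\alpha$ from its edges to $\mathbb{N}$ such that at most $k$ edges with a common endpoint receive the same color; it is an improper interval coloring if at every vertex the colors on incident edges form a set of consecutive integers. $\mu_{\mathrm{int}}(G)$ is the smallest $k$ such that $G$ has a $k$-improper interval edge coloring. -}

module Defs where

open import Data.Nat using (ℕ; _≤_; _≡ᵇ_)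
open import Data.Bool using (Bool; true; false; _∧_; _∨_; T)
open import Data.Fin using (Fin; remQuot; _≟_)
open import Data.List using (List; length; filterᵇ)
open import Data.Fin.Base using ()
open import Data.List using (allFin)
open import Data.Product using (_×_; _,_; ∃-syntax)
open import Relation.Nullary.Decidable using (⌊_⌋)
open import Relation.Binary.PropositionalEquality using (_≡_)

record Graph : Set where
  field
    n   : ℕ
    adj : Fin n → Fin n → Bool

open Graph public

IsSimple : Graph → Set
IsSimple G = (∀ u v → adj G u v ≡ adj G v u) × (∀ u → adj G u u ≡ false)

_□_ : Graph → Graph → Graph
G □ H = record
  { n   = n G Data.Nat.* n H
  ; adj = λ i j → pAdj (remQuot (n H) i) (remQuot (n H) j) }
  where
  open import Data.Nat using (_*_)
  pAdj : Fin (n G) × Fin (n H) → Fin (n G) × Fin (n H) → Bool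
  pAdj (u₁ , v₁) (u₂ , v₂) =
    (⌊ u₁ ≟ u₂ ⌋ ∧ adj H v₁ v₂) ∨ (⌊ v₁ ≟ v₂ ⌋ ∧ adj G u₁ u₂)

-- An edge colouring: colour c u v of the edge uv (symmetric on edges).
-- Values on non-adjacent pairs are irrelevant.
IsEdgeColoring : (G : Graph) → (Fin (n G) → Fin (n G) → ℕ) → Set
IsEdgeColoring G c = ∀ u v → T (adj G u v) → c u v ≡ c v u

colorDegree : (G : Graph) → (Fin (n G) → Fin (n G) → ℕ) → Fin (n G) → ℕ → ℕ
colorDegree G c v i = length (filterᵇ (λ w → adj G v w ∧ (c v w ≡ᵇ i)) (allFin (n G)))

IsKImproper : (G : Graph) → ℕ → (Fin (n G) → Fin (n G) → ℕ) → Set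
IsKImproper G k c = ∀ v i → colorDegree G c v i ≤ k

ColorAt : (G : Graph) → (Fin (n G) → Fin (n G) → ℕ) → Fin (n G) → ℕ → Set
ColorAt G c v i = ∃[ w ] (T (adj G v w) × c v w ≡ i)

IsInterval : (G : Graph) → (Fin (n G) → Fin (n G) → ℕ) → Set
IsInterval G c = ∀ v a b j → ColorAt G c v a → ColorAt G c v b →
  a ≤ j → j ≤ b → ColorAt G c v j

HasImproperInterval : Graph → ℕ → Set
HasImproperInterval G k = ∃[ c ] (IsEdgeColoring G c × IsKImproper G k c × IsInterval G c)

IsMuInt : Graph → ℕ → Set
IsMuInt G k = HasImproperInterval G k × (∀ k' → HasImproperInterval G k' → k ≤ k')

module Submission where

-- Color an edge (u , v)(u′ , v) of G □ H by α u u′ + L v and an edge (u , v)(u , v′) by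
-- β v v′ + R u + 1, where R u is the largest α-color at u and L v the least β-color at v.
-- At the vertex (u , v) the first kind of edge then carries the interval of α-colors at u
-- shifted to end at R u + L v, the second the interval of β-colors at v shifted to start at
-- R u + L v + 1; their union is again an interval, and every color class at (u , v) lies
-- entirely in one copy of G or of H, so its size is bounded by the improperness of α or of β.

open import Data.Bool using (Bool; true; false; T; _∧_; _∨_; if_then_else_)
open import Data.Bool.Properties using (T-∧; T-∨)
open import Data.Empty using (⊥-elim)
open import Data.Fin using (Fin; zero; suc; remQuot; combine; _↑ˡ_; _↑ʳ_; _≟_)
open import Data.Fin.Properties using (splitAt-↑ʳ; remQuot-combine; suc-injective)
open import Data.List using (length; filterᵇ; tabulate; allFin)
open import Data.Nat using (ℕ; zero; suc; _+_; _*_; _∸_; _≤_; _<_; _⊔_; _≡ᵇ_; z≤n; _≤?_)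
open import Data.Nat.Properties
  using ( ≤-refl; ≤-trans; ≤-reflexive; ≤-isTotalPreorder; ≰⇒>; <⇒≱; ≤⇒≯; m≤n+m; m≤m⊔n; m≤n⊔m
        ; +-comm; +-assoc; +-suc; +-identityʳ; +-mono-≤; +-monoˡ-≤; +-0-commutativeMonoid
        ; ∸-monoˡ-≤; m+n≤o⇒m≤o∸n; m+n∸n≡m; m∸n+n≡m; ≡ᵇ⇒≡; ≡⇒≡ᵇ; module ≤-Reasoning )
open import Data.Product using (_×_; _,_; ∃; ∃-syntax; proj₁; proj₂; map₁)
open import Data.Sum using (_⊎_; inj₁; inj₂)
open import Function using (_∘_; id; Equivalence)
open import Relation.Binary using (Rel; IsTotalPreorder)
import Relation.Binary.Construct.Flip.EqAndOrd as Flip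
open import Relation.Binary.PropositionalEquality using (_≡_; _≢_; refl; sym; trans; cong; cong₂; subst; module ≡-Reasoning)
open import Relation.Nullary using (¬_; yes; no; contradiction)
open import Relation.Nullary.Decidable using (⌊_⌋; T?)

open import Defs

open import Algebra.Properties.CommutativeMonoid.Sum +-0-commutativeMonoid
  using (sum; sum-syntax; sum-cong-≗; sum-replicate-zero)

open Equivalence using (to; from)

indicator : Bool → ℕ
indicator true  = 1
indicator false = 0

indicator-mono : ∀ {b c} → (T b → T c) → indicator b ≤ indicator c
indicator-mono {false}         _   = z≤n
indicator-mono {true} {true}   _   = ≤-refl
indicator-mono {true} {false} b⇒c = ⊥-elim (b⇒c _)

indicator-false : ∀ {b} → ¬ T b → indicator b ≡ 0
indicator-false {false} _  = refl
indicator-false {true}  ¬b = ⊥-elim (¬b _)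

∑-mono-≤ : ∀ {n} {f g : Fin n → ℕ} → (∀ i → f i ≤ g i) → sum f ≤ sum g
∑-mono-≤ {zero}  f≤g = z≤n
∑-mono-≤ {suc n} f≤g = +-mono-≤ (f≤g zero) (∑-mono-≤ (f≤g ∘ suc))

∑-single : ∀ {n} (f : Fin n → ℕ) (j : Fin n) → (∀ i → i ≢ j → f i ≡ 0) → sum f ≡ f j
∑-single {suc n} f zero    f≡0 = begin
  f zero + sum (f ∘ suc)  ≡⟨ cong (f zero +_) (sum-cong-≗ (λ i → f≡0 (suc i) λ ())) ⟩
  f zero + sum {n} (λ _ → 0) ≡⟨ cong (f zero +_) (sum-replicate-zero n) ⟩
  f zero + 0              ≡⟨ +-identityʳ (f zero) ⟩
  f zero                  ∎
  where open ≡-Reasoning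
∑-single {suc n} f (suc j) f≡0 =
  trans (cong (_+ sum (f ∘ suc)) (f≡0 zero λ ()))
        (∑-single (f ∘ suc) j (λ i i≢j → f≡0 (suc i) (i≢j ∘ suc-injective)))

∑-↑ : ∀ m {n} (f : Fin (m + n) → ℕ) →
  sum f ≡ ∑[ i < m ] f (i ↑ˡ n) + ∑[ j < n ] f (m ↑ʳ j)
∑-↑ zero    f = refl
∑-↑ (suc m) f = trans (cong (f zero +_) (∑-↑ m (f ∘ suc))) (sym (+-assoc (f zero) _ _))

remQuot-↑ʳ : ∀ m n (i : Fin (m * n)) → remQuot {suc m} n (n ↑ʳ i) ≡ map₁ suc (remQuot {m} n i)
remQuot-↑ʳ m n i rewrite splitAt-↑ʳ n (m * n) i = refl

∃-remQuot : ∀ {m n} (P : Fin m × Fin n → Set) → ∃ P → ∃ (P ∘ remQuot n)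
∃-remQuot P ((u , v) , Puv) = combine u v , subst P (sym (remQuot-combine u v)) Puv

∑-remQuot : ∀ m n (g : Fin m × Fin n → ℕ) →
  ∑[ i < m * n ] g (remQuot n i) ≡ ∑[ u < m ] ∑[ v < n ] g (u , v)
∑-remQuot zero    n g = refl
∑-remQuot (suc m) n g = begin
  ∑[ i < n + m * n ] g (remQuot n i)
    ≡⟨ ∑-↑ n (g ∘ remQuot n) ⟩
  ∑[ v < n ] g (remQuot n (v ↑ˡ m * n)) + ∑[ i < m * n ] g (remQuot n (n ↑ʳ i))
    ≡⟨ cong₂ _+_ (sum-cong-≗ (cong g ∘ remQuot-combine zero))
                 (sum-cong-≗ (cong g ∘ remQuot-↑ʳ m n)) ⟩
  ∑[ v < n ] g (zero , v) + ∑[ i < m * n ] g (map₁ suc (remQuot n i))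
    ≡⟨ cong (∑[ v < n ] g (zero , v) +_) (∑-remQuot m n (g ∘ map₁ suc)) ⟩
  ∑[ v < n ] g (zero , v) + ∑[ u < m ] ∑[ v < n ] g (suc u , v)
    ∎
  where open ≡-Reasoning

count : ∀ {n} → (Fin n → Bool) → ℕ
count {n} p = length (filterᵇ p (allFin n))

length-filterᵇ-tabulate : ∀ {a} {A : Set a} {n} (p : A → Bool) (f : Fin n → A) →
  length (filterᵇ p (tabulate f)) ≡ ∑[ i < n ] indicator (p (f i))
length-filterᵇ-tabulate {n = zero}  p f = refl
length-filterᵇ-tabulate {n = suc n} p f with p (f zero)
... | true  = cong suc (length-filterᵇ-tabulate p (f ∘ suc))
... | false = length-filterᵇ-tabulate p (f ∘ suc)

count≡∑ : ∀ {n} (p : Fin n → Bool) → count p ≡ ∑[ i < n ] indicator (p i)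
count≡∑ p = length-filterᵇ-tabulate p id

count-mono : ∀ {n} {p q : Fin n → Bool} → (∀ i → T (p i) → T (q i)) → count p ≤ count q
count-mono {p = p} {q} p⇒q rewrite count≡∑ p | count≡∑ q = ∑-mono-≤ (λ i → indicator-mono (p⇒q i))

count-none : ∀ {n} (p : Fin n → Bool) → (∀ i → ¬ T (p i)) → count p ≡ 0
count-none {n} p none = trans (count≡∑ p)
  (trans (sum-cong-≗ (indicator-false ∘ none)) (sum-replicate-zero n))

count-remQuot : ∀ {m n} (p : Fin m × Fin n → Bool) →
  count (p ∘ remQuot n) ≡ ∑[ u < m ] count (λ v → p (u , v))
count-remQuot {m} {n} p = trans (count≡∑ (p ∘ remQuot n))
  (trans (∑-remQuot m n (indicator ∘ p)) (sum-cong-≗ (sym ∘ λ u → count≡∑ (λ v → p (u , v)))))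

count-remQuot-fixed₁ : ∀ {m n} (p : Fin m × Fin n → Bool) u₀ →
  (∀ u v → T (p (u , v)) → u ≡ u₀) → count (p ∘ remQuot n) ≡ count (λ v → p (u₀ , v))
count-remQuot-fixed₁ p u₀ fixed = trans (count-remQuot p)
  (∑-single _ u₀ λ u u≢u₀ → count-none _ λ v pᵤᵥ → u≢u₀ (fixed u v pᵤᵥ))

count-remQuot-fixed₂ : ∀ {m n} (p : Fin m × Fin n → Bool) v₀ →
  (∀ u v → T (p (u , v)) → v ≡ v₀) → count (p ∘ remQuot n) ≡ count (λ u → p (u , v₀))
count-remQuot-fixed₂ {m} {n} p v₀ fixed = begin
  count (p ∘ remQuot n)                 ≡⟨ count-remQuot p ⟩
  ∑[ u < m ] count (λ v → p (u , v))    ≡⟨ sum-cong-≗ count-row ⟩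
  ∑[ u < m ] indicator (p (u , v₀))     ≡⟨ count≡∑ (λ u → p (u , v₀)) ⟨
  count (λ u → p (u , v₀))              ∎
  where
  open ≡-Reasoning
  count-row : ∀ u → count (λ v → p (u , v)) ≡ indicator (p (u , v₀))
  count-row u = trans (count≡∑ (λ v → p (u , v)))
    (∑-single _ v₀ λ v v≢v₀ → indicator-false (v≢v₀ ∘ fixed u v))

module _ {a ℓ} {A : Set a} {_≼_ : Rel A ℓ} (≼-isTotalPreorder : IsTotalPreorder _≡_ _≼_) where

  open IsTotalPreorder ≼-isTotalPreorder using (total) renaming (refl to ≼-refl; trans to ≼-trans)

  argmax-or-empty : ∀ {n} (p : Fin n → Bool) (f : Fin n → A) →
    (∀ w → ¬ T (p w)) ⊎ ∃[ w ] (T (p w) × ∀ w′ → T (p w′) → f w′ ≼ f w)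
  argmax-or-empty {zero} p f = inj₁ λ ()
  argmax-or-empty {suc n} p f with T? (p zero) | argmax-or-empty (p ∘ suc) (f ∘ suc)
  ... | no ¬p₀ | inj₁ none = inj₁ λ { zero → ¬p₀ ; (suc w) → none w }
  ... | no ¬p₀ | inj₂ (w , pw , w-best) =
    inj₂ (suc w , pw , λ { zero p₀ → contradiction p₀ ¬p₀ ; (suc w′) → w-best w′ })
  ... | yes p₀ | inj₁ none =
    inj₂ (zero , p₀ , λ { zero _ → ≼-refl ; (suc w′) pw′ → contradiction pw′ (none w′) })
  ... | yes p₀ | inj₂ (w , pw , w-best) with total (f zero) (f (suc w))
  ...   | inj₁ f₀≼ = inj₂ (suc w , pw , λ { zero _ → f₀≼ ; (suc w′) → w-best w′ })
  ...   | inj₂ ≼f₀ = inj₂ (zero , p₀ , λ { zero _ → ≼-refl ; (suc w′) pw′ → ≼-trans (w-best w′ pw′) ≼f₀ })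

Consecutive : (ℕ → Set) → Set
Consecutive S = ∀ a b j → S a → S b → a ≤ j → j ≤ b → S j

Consecutive-resp : ∀ {S S′ : ℕ → Set} → (∀ {j} → S j → S′ j) → (∀ {j} → S′ j → S j) →
  Consecutive S → Consecutive S′
Consecutive-resp S⇒S′ S′⇒S cS a b j S′a S′b a≤j j≤b = S⇒S′ (cS a b j (S′⇒S S′a) (S′⇒S S′b) a≤j j≤b)

Shift : ℕ → (ℕ → Set) → ℕ → Set
Shift s S j = ∃[ i ] (S i × i + s ≡ j)

Consecutive-Shift : ∀ s {S} → Consecutive S → Consecutive (Shift s S)
Consecutive-Shift s cS _ _ j (i₁ , Si₁ , refl) (i₂ , Si₂ , refl) i₁+s≤j j≤i₂+s =
  j ∸ s , cS i₁ i₂ (j ∸ s) Si₁ Si₂ (m+n≤o⇒m≤o∸n i₁ i₁+s≤j)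
                     (≤-trans (∸-monoˡ-≤ s j≤i₂+s) (≤-reflexive (m+n∸n≡m i₂ s)))
        , m∸n+n≡m (≤-trans (m≤n+m s i₁) i₁+s≤j)

Consecutive-⊎ : ∀ {S T} m → Consecutive S → Consecutive T →
  (∀ {i} → S i → i ≤ m) → (∀ {i} → T i → m < i) →
  (∀ {i} → S i → S m) → (∀ {i} → T i → T (suc m)) →
  Consecutive (λ j → S j ⊎ T j)
Consecutive-⊎ m cS _  _   _   _   _      a b j (inj₁ Sa) (inj₁ Sb) a≤j j≤b = inj₁ (cS a b j Sa Sb a≤j j≤b)
Consecutive-⊎ m _  cT _   _   _   _      a b j (inj₂ Ta) (inj₂ Tb) a≤j j≤b = inj₂ (cT a b j Ta Tb a≤j j≤b)
Consecutive-⊎ m cS cT _   _   S∋m T∋1+m a b j (inj₁ Sa) (inj₂ Tb) a≤j j≤b with j ≤? m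
... | yes j≤m = inj₁ (cS a m j Sa (S∋m Sa) a≤j j≤m)
... | no  j≰m = inj₂ (cT (suc m) b j (T∋1+m Tb) Tb (≰⇒> j≰m) j≤b)
Consecutive-⊎ m _  _  S≤m m<T _   _      a b j (inj₂ Ta) (inj₁ Sb) a≤j j≤b =
  contradiction (≤-trans a≤j (≤-trans j≤b (S≤m Sb))) (<⇒≱ (m<T Ta))

Coloring : Graph → Set
Coloring G = Fin (n G) → Fin (n G) → ℕ

module _ {ℓ} {_≼_ : Rel ℕ ℓ} (≼-isTotalPreorder : IsTotalPreorder _≡_ _≼_) (G : Graph) (c : Coloring G) where

  -- 0 at a vertex without edges; only its values at non-isolated vertices matter.
  extremeColor : Fin (n G) → ℕ
  extremeColor u with argmax-or-empty ≼-isTotalPreorder (adj G u) (c u)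
  ... | inj₁ _           = 0
  ... | inj₂ (w , _ , _) = c u w

  extremeColor-bound : ∀ {u w} → T (adj G u w) → c u w ≼ extremeColor u
  extremeColor-bound {u} {w} uw with argmax-or-empty ≼-isTotalPreorder (adj G u) (c u)
  ... | inj₁ none              = contradiction uw (none w)
  ... | inj₂ (_ , _ , w-best) = w-best w uw

  extremeColor-attained : ∀ {u w} → T (adj G u w) → ColorAt G c u (extremeColor u)
  extremeColor-attained {u} {w} uw with argmax-or-empty ≼-isTotalPreorder (adj G u) (c u)
  ... | inj₁ none          = contradiction uw (none w)
  ... | inj₂ (w′ , uw′ , _) = w′ , uw′ , refl

maxColor minColor : (G : Graph) → Coloring G → Fin (n G) → ℕ
maxColor = extremeColor ≤-isTotalPreorder
minColor = extremeColor (Flip.isTotalPreorder ≤-isTotalPreorder)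

module ProductColoring (G H : Graph) (irreflexive : ∀ u → adj G u u ≡ false)
                        (α : Coloring G) (β : Coloring H) where

  Vertex : Set
  Vertex = Fin (n G) × Fin (n H)

  -- adj (G □ H) x y reduces to productAdj (remQuot _ x) (remQuot _ y).
  productAdj : Vertex → Vertex → Bool
  productAdj (u₁ , v₁) (u₂ , v₂) = (⌊ u₁ ≟ u₂ ⌋ ∧ adj H v₁ v₂) ∨ (⌊ v₁ ≟ v₂ ⌋ ∧ adj G u₁ u₂)

  data ProductEdge : Vertex → Vertex → Set where
    vertical   : ∀ {u v v′} → T (adj H v v′) → ProductEdge (u , v) (u , v′)
    horizontal : ∀ {u u′ v} → T (adj G u u′) → ProductEdge (u , v) (u′ , v)

  productEdge : ∀ p q → T (productAdj p q) → ProductEdge p q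
  productEdge (u₁ , v₁) (u₂ , v₂) e with to (T-∨ {⌊ u₁ ≟ u₂ ⌋ ∧ adj H v₁ v₂}) e
  ... | inj₁ e′ with u₁ ≟ u₂
  ...   | yes refl = vertical e′
  productEdge (u₁ , v₁) (u₂ , v₂) e | inj₂ e′ with v₁ ≟ v₂
  ...   | yes refl = horizontal e′

  productEdge-adj : ∀ {p q} → ProductEdge p q → T (productAdj p q)
  productEdge-adj (vertical {u} {v} {v′} vv) with u ≟ u
  ... | yes _   = from (T-∨ {adj H v v′}) (inj₁ vv)
  ... | no u≢u = contradiction refl u≢u
  productEdge-adj (horizontal {u} {u′} {v} uu) with v ≟ v
  ... | yes _   = from (T-∨ {⌊ u ≟ u′ ⌋ ∧ adj H v v}) (inj₂ uu)
  ... | no v≢v = contradiction refl v≢v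

  R : Fin (n G) → ℕ
  R = maxColor G α

  L : Fin (n H) → ℕ
  L = minColor H β

  color : Vertex → Vertex → ℕ
  color (u₁ , v₁) (u₂ , v₂) = if ⌊ u₁ ≟ u₂ ⌋ then β v₁ v₂ + suc (R u₁) else α u₁ u₂ + L v₁

  γ : Coloring (G □ H)
  γ x y = color (remQuot (n H) x) (remQuot (n H) y)

  adj⇒≢ : ∀ {u u′} → T (adj G u u′) → u ≢ u′
  adj⇒≢ {u} uu refl = subst T (irreflexive u) uu

  color-vertical : ∀ u v v′ → color (u , v) (u , v′) ≡ β v v′ + suc (R u)
  color-vertical u v v′ with u ≟ u
  ... | yes _   = refl
  ... | no u≢u = contradiction refl u≢u

  color-horizontal : ∀ {u u′} v → u ≢ u′ → color (u , v) (u′ , v) ≡ α u u′ + L v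
  color-horizontal {u} {u′} v u≢u′ with u ≟ u′
  ... | yes u≡u′ = contradiction u≡u′ u≢u′
  ... | no _     = refl

  color-sym : IsEdgeColoring G α → IsEdgeColoring H β →
    ∀ p q → T (productAdj p q) → color p q ≡ color q p
  color-sym symα symβ p q e with productEdge p q e
  ... | vertical {u} {v} {v′} vv = begin
    color (u , v) (u , v′)  ≡⟨ color-vertical u v v′ ⟩
    β v v′ + suc (R u)      ≡⟨ cong (_+ suc (R u)) (symβ v v′ vv) ⟩
    β v′ v + suc (R u)      ≡⟨ color-vertical u v′ v ⟨
    color (u , v′) (u , v)  ∎
    where open ≡-Reasoning
  ... | horizontal {u} {u′} {v} uu = begin
    color (u , v) (u′ , v)  ≡⟨ color-horizontal v (adj⇒≢ uu) ⟩
    α u u′ + L v            ≡⟨ cong (_+ L v) (symα u u′ uu) ⟩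
    α u′ u + L v            ≡⟨ color-horizontal v (adj⇒≢ uu ∘ sym) ⟨
    color (u′ , v) (u , v)  ∎
    where open ≡-Reasoning

  pivot : Fin (n G) → Fin (n H) → ℕ
  pivot u v = R u + L v

  horizontal≤pivot : ∀ {u u′} v → T (adj G u u′) → α u u′ + L v ≤ pivot u v
  horizontal≤pivot v uu = +-monoˡ-≤ (L v) (extremeColor-bound ≤-isTotalPreorder G α uu)

  suc-pivot : ∀ u v → L v + suc (R u) ≡ suc (pivot u v)
  suc-pivot u v = trans (+-suc (L v) (R u)) (cong suc (+-comm (L v) (R u)))

  pivot<vertical : ∀ u {v v′} → T (adj H v v′) → pivot u v < β v v′ + suc (R u)
  pivot<vertical u {v} {v′} vv = subst (_≤ β v v′ + suc (R u)) (suc-pivot u v)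
    (+-monoˡ-≤ (suc (R u)) (extremeColor-bound (Flip.isTotalPreorder ≤-isTotalPreorder) H β vv))

  ColorAtPair : Vertex → ℕ → Set
  ColorAtPair p j = ∃[ q ] (T (productAdj p q) × color p q ≡ j)

  HorizontalColor VerticalColor : Fin (n G) → Fin (n H) → ℕ → Set
  HorizontalColor u v = Shift (L v) (ColorAt G α u)
  VerticalColor   u v = Shift (suc (R u)) (ColorAt H β v)

  ColorAtPair-split : ∀ {u v j} → ColorAtPair (u , v) j → HorizontalColor u v j ⊎ VerticalColor u v j
  ColorAtPair-split {u} {v} (q , e , refl) with productEdge (u , v) q e
  ... | vertical {v′ = v′} vv  = inj₂ (β v v′ , (v′ , vv , refl) , sym (color-vertical u v v′))
  ... | horizontal {u′ = u′} uu = inj₁ (α u u′ , (u′ , uu , refl) , sym (color-horizontal v (adj⇒≢ uu)))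

  ColorAtPair-join : ∀ {u v j} → HorizontalColor u v j ⊎ VerticalColor u v j → ColorAtPair (u , v) j
  ColorAtPair-join {u} {v} (inj₁ (_ , (u′ , uu , refl) , refl)) =
    (u′ , v) , productEdge-adj (horizontal uu) , color-horizontal v (adj⇒≢ uu)
  ColorAtPair-join {u} {v} (inj₂ (_ , (v′ , vv , refl) , refl)) =
    (u , v′) , productEdge-adj (vertical vv) , color-vertical u v v′

  ColorAtPair-consecutive : IsInterval G α → IsInterval H β → ∀ p → Consecutive (ColorAtPair p)
  ColorAtPair-consecutive intα intβ (u , v) = Consecutive-resp ColorAtPair-join ColorAtPair-split
    (Consecutive-⊎ (pivot u v) (Consecutive-Shift (L v) (intα u)) (Consecutive-Shift (suc (R u)) (intβ v))
      (λ { (_ , (_ , uu , refl) , refl) → horizontal≤pivot v uu })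
      (λ { (_ , (_ , vv , refl) , refl) → pivot<vertical u vv })
      (λ { (_ , (_ , uu , _) , _) → R u , extremeColor-attained ≤-isTotalPreorder G α uu , refl })
      (λ { (_ , (_ , vv , _) , _) →
             L v , extremeColor-attained (Flip.isTotalPreorder ≤-isTotalPreorder) H β vv , suc-pivot u v }))

  OfColor : Vertex → ℕ → Vertex → Bool
  OfColor p k q = productAdj p q ∧ (color p q ≡ᵇ k)

  OfColor-edge : ∀ p k q → T (OfColor p k q) → ProductEdge p q × color p q ≡ k
  OfColor-edge p k q e with to (T-∧ {productAdj p q}) e
  ... | pq , color≡ᵇk = productEdge p q pq , ≡ᵇ⇒≡ (color p q) k color≡ᵇk

  low-color : ∀ {u v k} → k ≤ pivot u v → ∀ u′ v′ → T (OfColor (u , v) k (u′ , v′)) →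
    v′ ≡ v × T (adj G u u′ ∧ (α u u′ ≡ᵇ k ∸ L v))
  low-color {u} {v} k≤pivot u′ v′ e with OfColor-edge (u , v) _ (u′ , v′) e
  ... | vertical vv , refl =
    contradiction (subst (_≤ pivot u v) (color-vertical u v v′) k≤pivot) (<⇒≱ (pivot<vertical u vv))
  ... | horizontal uu , refl = refl , from T-∧ (uu , ≡⇒≡ᵇ _ _ (sym (begin
    color (u , v) (u′ , v) ∸ L v  ≡⟨ cong (_∸ L v) (color-horizontal v (adj⇒≢ uu)) ⟩
    α u u′ + L v ∸ L v             ≡⟨ m+n∸n≡m (α u u′) (L v) ⟩
    α u u′                         ∎)))
    where open ≡-Reasoning

  high-color : ∀ {u v k} → pivot u v < k → ∀ u′ v′ → T (OfColor (u , v) k (u′ , v′)) →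
    u′ ≡ u × T (adj H v v′ ∧ (β v v′ ≡ᵇ k ∸ suc (R u)))
  high-color {u} {v} pivot<k u′ v′ e with OfColor-edge (u , v) _ (u′ , v′) e
  ... | horizontal uu , refl =
    contradiction (subst (pivot u v <_) (color-horizontal v (adj⇒≢ uu)) pivot<k) (≤⇒≯ (horizontal≤pivot v uu))
  ... | vertical vv , refl = refl , from T-∧ (vv , ≡⇒≡ᵇ _ _ (sym (begin
    color (u , v) (u , v′) ∸ suc (R u)  ≡⟨ cong (_∸ suc (R u)) (color-vertical u v v′) ⟩
    β v v′ + suc (R u) ∸ suc (R u)       ≡⟨ m+n∸n≡m (β v v′) (suc (R u)) ⟩
    β v v′                               ∎)))
    where open ≡-Reasoning

  degree-low : ∀ {u v k} → k ≤ pivot u v →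
    count (OfColor (u , v) k ∘ remQuot (n H)) ≤ colorDegree G α u (k ∸ L v)
  degree-low {u} {v} {k} k≤pivot = begin
    count (OfColor (u , v) k ∘ remQuot (n H))
      ≡⟨ count-remQuot-fixed₂ (OfColor (u , v) k) v (λ u′ v′ → proj₁ ∘ low-color k≤pivot u′ v′) ⟩
    count (λ u′ → OfColor (u , v) k (u′ , v))
      ≤⟨ count-mono (λ u′ → proj₂ ∘ low-color k≤pivot u′ v) ⟩
    colorDegree G α u (k ∸ L v)
      ∎
    where open ≤-Reasoning

  degree-high : ∀ {u v k} → pivot u v < k →
    count (OfColor (u , v) k ∘ remQuot (n H)) ≤ colorDegree H β v (k ∸ suc (R u))
  degree-high {u} {v} {k} pivot<k = begin
    count (OfColor (u , v) k ∘ remQuot (n H))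
      ≡⟨ count-remQuot-fixed₁ (OfColor (u , v) k) u (λ u′ v′ → proj₁ ∘ high-color pivot<k u′ v′) ⟩
    count (λ v′ → OfColor (u , v) k (u , v′))
      ≤⟨ count-mono (λ v′ → proj₂ ∘ high-color pivot<k u v′) ⟩
    colorDegree H β v (k ∸ suc (R u))
      ∎
    where open ≤-Reasoning

  □-edgeColoring : IsEdgeColoring G α → IsEdgeColoring H β → IsEdgeColoring (G □ H) γ
  □-edgeColoring symα symβ x y = color-sym symα symβ (remQuot (n H) x) (remQuot (n H) y)

  □-improper : ∀ {a b} → IsKImproper G a α → IsKImproper H b β → IsKImproper (G □ H) (a ⊔ b) γ
  □-improper {a} {b} degα degβ x k = degree (remQuot (n H) x)
    where
    degree : ∀ p → count (OfColor p k ∘ remQuot (n H)) ≤ a ⊔ b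
    degree (u , v) with k ≤? pivot u v
    ... | yes k≤pivot = ≤-trans (degree-low k≤pivot) (≤-trans (degα u (k ∸ L v)) (m≤m⊔n a b))
    ... | no  k≰pivot = ≤-trans (degree-high (≰⇒> k≰pivot)) (≤-trans (degβ v (k ∸ suc (R u))) (m≤n⊔m a b))

  □-interval : IsInterval G α → IsInterval H β → IsInterval (G □ H) γ
  □-interval intα intβ x = Consecutive-resp (∃-remQuot _) (λ (y , e , c) → remQuot (n H) y , e , c)
    (ColorAtPair-consecutive intα intβ (remQuot (n H) x))

□-hasImproperInterval : ∀ {a b} (G H : Graph) → (∀ u → adj G u u ≡ false) →
  HasImproperInterval G a → HasImproperInterval H b → HasImproperInterval (G □ H) (a ⊔ b)
□-hasImproperInterval G H irreflexive (α , symα , degα , intα) (β , symβ , degβ , intβ) =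
  γ , □-edgeColoring symα symβ , □-improper degα degβ , □-interval intα intβ
  where open ProductColoring G H irreflexive α β

proposition33 : (G H : Graph) → IsSimple G → IsSimple H →
    (a b c : ℕ) → IsMuInt G a → IsMuInt H b → IsMuInt (G □ H) c →
    c ≤ a ⊔ b
proposition33 G H (_ , irreflexive) _ a b c (coloringG , _) (coloringH , _) (_ , minimal) =
  minimal (a ⊔ b) (□-hasImproperInterval G H irreflexive coloringG coloringH)
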